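{- Let $q$ be a prime power, $d\ge2$, and $n,l$ positive integers with $l-1\ge(d-1)(n-1)$. Then $\mathrm{Q}_{\mathbb{F}_q}\left(T_{d,\mathbb{F}_{q^n}}\right)\le\mathrm{Q}_{\mathbb{F}_q}\left(T_{d,\mathbb{F}_{q^l}}\right)$.
   Context: For a finite extension $\mathbb{L}/\mathbb{K}$ of degree $m$ and $d\ge2$, $T_{d,\mathbb{L}}\in(\mathbb{K}^m)^{\otimes d}$ is the structure tensor over $\mathbb{K}$ of $\mathbb{L}^{d-1}\to\mathbb{L}$, $(x_1,\dots,x_{d-1})\mapsto x_1\cdots x_{d-1}$ (coefficients w.r.t. a $\mathbb{K}$-basis of $\mathbb{L}$); here $\mathbb{K}=\mathbb{F}_q$. $S\preceq T$ means $S=(g_1\otimes\cdots\otimes g_d)T$ for linear maps $g_i$; $\mathrm{Id}_s=\sum_{j=1}^se_j^{\otimes d}$; $\mathrm{Q}_{\mathbb{K}}(T)=\max\{s:\mathrm{Id}_s\preceq T\}$. -}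

module Defs where

open import Level using (Level; _⊔_) renaming (suc to lsuc)
open import Data.Nat using (ℕ; zero; suc; _^_)
open import Data.Nat.Primality using (Prime)
open import Data.Fin using (Fin; _≟_; fromℕ; inject₁)
open import Data.Vec.Functional using (_∷_)
open import Data.Product using (Σ; ∃; _×_; _,_; proj₁)
open import Relation.Nullary using (¬_; yes; no)
open import Relation.Binary.PropositionalEquality using (_≡_)
open import Algebra.Bundles using (CommutativeRing)
open import Algebra.Morphism.Structures using (IsRingHomomorphism)

IsPrimePower : ℕ → Set
IsPrimePower q = ∃ λ p → ∃ λ k → Prime p × q ≡ p ^ suc k

record Field (c ℓ : Level) : Set (lsuc (c ⊔ ℓ)) where
  field
    commutativeRing : CommutativeRing c ℓ
  open CommutativeRing commutativeRing public
  field
    1≉0     : ¬ (1# ≈ 0#)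
    inverse : ∀ x → ¬ (x ≈ 0#) → ∃ λ y → (x * y) ≈ 1#

foldFin : ∀ {a} {A : Set a} → (A → A → A) → A → ∀ {m} → (Fin m → A) → A
foldFin _∙_ e {zero}  f = e
foldFin _∙_ e {suc m} f = f Fin.zero ∙ foldFin _∙_ e (λ i → f (Fin.suc i))

HasSize : ∀ {c ℓ} → Field c ℓ → ℕ → Set (c ⊔ ℓ)
HasSize K q = Σ (Fin q → Carrier) λ e →
                 (∀ x → ∃ λ i → e i ≈ x) × (∀ i j → e i ≈ e j → i ≡ j)
  where open Field K

record Extension {c ℓ} (K : Field c ℓ) (c' ℓ' : Level) (m : ℕ)
       : Set (lsuc (c ⊔ ℓ ⊔ c' ⊔ ℓ')) where
  module K = Field K
  field
    L     : Field c' ℓ'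
  module L = Field L
  field
    ι     : K.Carrier → L.Carrier
    ι-hom : IsRingHomomorphism K.rawRing L.rawRing ι
    basis : Fin m → L.Carrier
  comb : (Fin m → K.Carrier) → L.Carrier
  comb cf = foldFin L._+_ L.0# (λ i → ι (cf i) L.* basis i)
  field
    spanning    : ∀ x → ∃ λ (cf : Fin m → K.Carrier) → x L.≈ comb cf
    independent : ∀ (cf : Fin m → K.Carrier) → comb cf L.≈ L.0# → ∀ i → cf i K.≈ K.0#
  coord : L.Carrier → Fin m → K.Carrier
  coord x = proj₁ (spanning x)

module _ {c ℓ} (K : Field c ℓ) where
  open Field K

  Tensor : ℕ → ℕ → Set c
  Tensor d m = (Fin d → Fin m) → Carrier

  ∑ : ∀ {m} → (Fin m → Carrier) → Carrier
  ∑ = foldFin _+_ 0#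

  ∏ : ∀ {m} → (Fin m → Carrier) → Carrier
  ∏ = foldFin _*_ 1#

  ∑Idx : ∀ d {m} → ((Fin d → Fin m) → Carrier) → Carrier
  ∑Idx zero    f = f (λ ())
  ∑Idx (suc d) f = ∑ (λ a → ∑Idx d (λ i → f (a ∷ i)))

  -- S ⪯ T :  S = (g_1 ⊗ … ⊗ g_d) T  for K-linear maps g_k : K^m → K^s
  -- (g_k given by its s × m matrix).
  _⪯_ : ∀ {d s m} → Tensor d s → Tensor d m → Set (c ⊔ ℓ)
  _⪯_ {d} {s} {m} S T =
    ∃ λ (g : Fin d → Fin s → Fin m → Carrier) →
      ∀ (j : Fin d → Fin s) →
        S j ≈ ∑Idx d (λ i → ∏ (λ k → g k (j k) (i k)) * T i)

  δ : ∀ {s} → Fin s → Fin s → Carrier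
  δ a x with x ≟ a
  ... | yes _ = 1#
  ... | no  _ = 0#

  Id : ∀ d s → Tensor d s
  Id d s j = ∑ (λ a → ∏ (λ k → δ a (j k)))

-- The structure tensor T_{d,L} ∈ (K^m)^{⊗ d} of the (d-1)-fold multiplication
-- L^{d-1} → L, (x_1,…,x_{d-1}) ↦ x_1⋯x_{d-1}, w.r.t. the K-basis of L:
-- T(i_1,…,i_d) = i_d-th coordinate of b_{i_1} ⋯ b_{i_{d-1}}.
-- (Only meaningful for d ≥ 2; the d = 0 case is an irrelevant dummy.)
structTensor : ∀ {c ℓ c' ℓ'} {K : Field c ℓ} {m} (E : Extension K c' ℓ' m)
               (d : ℕ) → Tensor K d m
structTensor {K = K} E zero    i = Field.0# K
structTensor {K = K} E (suc e) i =
  coord (foldFin L._*_ L.1# (λ k → basis (i (inject₁ k)))) (i (fromℕ e))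
  where open Extension E

-- Fix power bases 1, β, …, β^(n-1) of F_{q^n} and 1, α, …, α^(l-1) of F_{q^l} over F_q. They exist:
-- if 1, α, …, α^(m-1) are dependent, take r < m least with 1, α, …, α^r dependent; the span of
-- 1, …, α^(r-1) then has q^r elements, contains 0 and is closed under multiplication by α, which
-- forces α^(q^r) = α. The polynomials x^(q^r) - x (1 ≤ r < m) have fewer than q^m roots in total.
--
-- In these bases elements are polynomials of degree < n, resp. < l. Lift y = Σ cᵢ βⁱ to Σ cᵢ αⁱ and
-- reduce Y = Σ cₜ αᵗ (t < l) to Σ cₜ βᵗ. A product of d - 1 lifts has degree ≤ (d-1)(n-1) ≤ l - 1,
-- so reducing it recovers the product in F_{q^n}: with lift on the inputs and reduce on the output,
-- T_{d,F_{q^n}} is a restriction of T_{d,F_{q^l}}, and Id_s ⪯ T_{d,F_{q^n}} gives Id_s ⪯ T_{d,F_{q^l}}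
-- by transitivity of ⪯.

module Submission where

open import Defs
open import Level using (Level; _⊔_)
open import Function.Base using (_∘_; id)
open import Data.Nat.Base as ℕ using (ℕ; zero; suc; _≤_; _<_; _∸_; z≤n; s≤s)
import Data.Nat.Properties as ℕ
open import Data.Fin.Base using (Fin; zero; suc; toℕ; fromℕ; fromℕ<; inject₁; punchIn)
open import Data.Fin.Properties as FinProperties
  using (_≟_; punchInᵢ≢i; toℕ≤pred[n]; toℕ-fromℕ<; toℕ-fromℕ; toℕ-inject₁; toℕ<n)
open import Data.Vec.Functional using (Vector; foldr) renaming (_∷_ to _∷ᵥ_)
open import Data.Vec.Functional.Relation.Binary.Equality.Setoid using (≋-setoid)
open import Data.List.Base as List using (List; []; _∷_; length)
open import Data.List.Properties
  using (length-removeAt′; length-++; length-map; length-replicate; length-tabulate)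
open import Data.List.Relation.Unary.All as All using (All; []; _∷_)
import Data.List.Relation.Unary.All.Properties as AllProperties
open import Data.List.Relation.Unary.Any as Any using (Any; here; there)
import Data.List.Relation.Unary.Any.Properties as AnyProperties
open import Data.List.Relation.Unary.AllPairs using ([]; _∷_)
import Data.List.Relation.Unary.Unique.Setoid.Properties as UniqueProperties
import Data.List.Membership.Setoid.Properties as MembershipProperties
open import Data.Product.Base using (∃; _×_; _,_; proj₁; proj₂)
open import Data.Sum.Base using (_⊎_; inj₁; inj₂)
open import Relation.Nullary using (¬_; Dec; yes; no; contradiction)
import Relation.Nullary.Decidable as Dec
open import Relation.Nullary.Decidable using (_→-dec_)
open import Relation.Unary using () renaming (Decidable to Decidable₁)
open import Relation.Unary.Properties using (∁?)
open import Relation.Binary.Bundles using (Setoid)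
open import Relation.Binary.Definitions using (Decidable)
open import Relation.Binary.PropositionalEquality.Core using (_≡_; _≢_)
import Relation.Binary.PropositionalEquality.Core as ≡
import Relation.Binary.Reasoning.Setoid as SetoidReasoning
open import Algebra.Bundles using (Monoid; CommutativeMonoid)
open import Algebra.Morphism.Structures using (module MonoidMorphisms; IsRingHomomorphism)
import Algebra.Properties.CommutativeMonoid.Sum as CommutativeMonoidSum
import Algebra.Properties.CommutativeSemigroup as CommutativeSemigroupProperties
import Algebra.Properties.Group as GroupProperties
import Algebra.Properties.Ring as RingProperties
import Algebra.Properties.Semiring.Exp as SemiringExp
import Algebra.Properties.Semiring.Sum as SemiringSum
import Algebra.Solver.Ring.NaturalCoefficients.Default as NaturalSolver

-- Finite sums and products
foldFin≡foldr : ∀ {a} {A : Set a} (_∙_ : A → A → A) (ε : A) {m} (f : Vector A m) →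
                foldFin _∙_ ε f ≡ foldr _∙_ ε f
foldFin≡foldr _∙_ ε {zero}  f = ≡.refl
foldFin≡foldr _∙_ ε {suc m} f = ≡.cong (f zero ∙_) (foldFin≡foldr _∙_ ε (f ∘ suc))

sumℕ : ∀ {e} → Vector ℕ e → ℕ
sumℕ = foldFin ℕ._+_ 0

module _ {a b ℓ₁ ℓ₂} (M : Monoid a ℓ₁) (N : Monoid b ℓ₂) where
  private
    module M = Monoid M
    module N = Monoid N
  open MonoidMorphisms M.rawMonoid N.rawMonoid using (IsMonoidHomomorphism)

  foldFin-homo : ∀ {φ} → IsMonoidHomomorphism φ → ∀ {m} (f : Vector M.Carrier m) →
                 φ (foldFin M._∙_ M.ε f) N.≈ foldFin N._∙_ N.ε (φ ∘ f)
  foldFin-homo hom {zero}  f = IsMonoidHomomorphism.ε-homo hom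
  foldFin-homo hom {suc m} f =
    N.trans (IsMonoidHomomorphism.homo hom _ _) (N.∙-congˡ (foldFin-homo hom (f ∘ suc)))

module FieldSums {c ℓ} (F : Field c ℓ) where
  open Field F hiding (zero)
  open SetoidReasoning setoid
  private
    module Σ = SemiringSum semiring
    module Π = CommutativeMonoidSum *-commutativeMonoid
  open SemiringExp semiring public using (_^_)
  open SemiringExp semiring using (^-congʳ; ^-homo-*)

  ∑≡sum : ∀ {m} (f : Vector Carrier m) → ∑ F f ≡ Σ.sum f
  ∑≡sum = foldFin≡foldr _+_ 0#

  ∏≡product : ∀ {m} (f : Vector Carrier m) → ∏ F f ≡ Π.sum f
  ∏≡product = foldFin≡foldr _*_ 1#

  ∑-cong : ∀ {m} {f g : Vector Carrier m} → (∀ i → f i ≈ g i) → ∑ F f ≈ ∑ F g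
  ∑-cong {f = f} {g} f≈g rewrite ∑≡sum f | ∑≡sum g = Σ.sum-cong-≋ f≈g

  ∏-cong : ∀ {m} {f g : Vector Carrier m} → (∀ i → f i ≈ g i) → ∏ F f ≈ ∏ F g
  ∏-cong {f = f} {g} f≈g rewrite ∏≡product f | ∏≡product g = Π.sum-cong-≋ f≈g

  ∑-zero : ∀ m → ∑ F {m} (λ _ → 0#) ≈ 0#
  ∑-zero m rewrite ∑≡sum {m} (λ _ → 0#) = Σ.sum-replicate-zero m

  ∑-distrib-+ : ∀ {m} (f g : Vector Carrier m) → ∑ F (λ i → f i + g i) ≈ ∑ F f + ∑ F g
  ∑-distrib-+ f g rewrite ∑≡sum (λ i → f i + g i) | ∑≡sum f | ∑≡sum g = Σ.∑-distrib-+ f g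

  ∏-distrib-* : ∀ {m} (f g : Vector Carrier m) → ∏ F (λ i → f i * g i) ≈ ∏ F f * ∏ F g
  ∏-distrib-* f g rewrite ∏≡product (λ i → f i * g i) | ∏≡product f | ∏≡product g = Π.∑-distrib-+ f g

  *-distribˡ-∑ : ∀ {m} x (f : Vector Carrier m) → x * ∑ F f ≈ ∑ F (λ i → x * f i)
  *-distribˡ-∑ x f rewrite ∑≡sum f | ∑≡sum (λ i → x * f i) = Σ.*-distribˡ-sum x f

  *-distribʳ-∑ : ∀ {m} x (f : Vector Carrier m) → ∑ F f * x ≈ ∑ F (λ i → f i * x)
  *-distribʳ-∑ x f rewrite ∑≡sum f | ∑≡sum (λ i → f i * x) = Σ.*-distribʳ-sum x f

  ∑-comm : ∀ {m n} (f : Fin m → Fin n → Carrier) →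
           ∑ F (λ i → ∑ F (f i)) ≈ ∑ F (λ j → ∑ F (λ i → f i j))
  ∑-comm f = begin
    ∑ F (λ i → ∑ F (f i))              ≡⟨ ∑∑≡sumsum f ⟩
    Σ.sum (λ i → Σ.sum (f i))          ≈⟨ Σ.∑-comm f ⟩
    Σ.sum (λ j → Σ.sum (λ i → f i j))  ≡⟨ ∑∑≡sumsum (λ j i → f i j) ⟨
    ∑ F (λ j → ∑ F (λ i → f i j))      ∎
    where
    ∑∑≡sumsum : ∀ {m n} (f : Fin m → Fin n → Carrier) →
                ∑ F (λ i → ∑ F (f i)) ≡ Σ.sum (λ i → Σ.sum (f i))
    ∑∑≡sumsum f = ≡.trans (∑≡sum (λ i → ∑ F (f i))) (Σ.sum-cong-≗ (λ i → ∑≡sum (f i)))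

  ∑-init-last : ∀ {m} (f : Vector Carrier (suc m)) → ∑ F f ≈ ∑ F (f ∘ inject₁) + f (fromℕ m)
  ∑-init-last f rewrite ∑≡sum f | ∑≡sum (f ∘ inject₁) = Σ.sum-init-last f

  δ-self : ∀ {m} (t : Fin m) → δ F t t ≈ 1#
  δ-self t with t ≟ t
  ... | yes _   = refl
  ... | no  t≢t = contradiction ≡.refl t≢t

  δ-other : ∀ {m} {t i : Fin m} → i ≢ t → δ F t i ≈ 0#
  δ-other {t = t} {i} i≢t with i ≟ t
  ... | yes i≡t = contradiction i≡t i≢t
  ... | no  _   = refl

  ∑-select : ∀ {m} (t : Fin m) (f : Vector Carrier m) → ∑ F (λ i → δ F t i * f i) ≈ f t
  ∑-select {suc m} t f = begin
    ∑ F (λ i → δ F t i * f i)    ≡⟨ ∑≡sum (λ i → δ F t i * f i) ⟩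
    Σ.sum (λ i → δ F t i * f i)  ≈⟨ Σ.sum-remove {i = t} (λ i → δ F t i * f i) ⟩
    δ F t t * f t + Σ.sum (λ j → δ F t (punchIn t j) * f (punchIn t j))
      ≈⟨ +-cong (*-congʳ (δ-self t)) (Σ.sum-cong-≋ (λ j → *-congʳ (δ-other (punchInᵢ≢i t j)))) ⟩
    1# * f t + Σ.sum (λ j → 0# * f (punchIn t j))
      ≈⟨ +-cong (*-identityˡ (f t)) (Σ.sum-cong-≋ (λ j → zeroˡ (f (punchIn t j)))) ⟩
    f t + Σ.sum {m} (λ _ → 0#)                             ≈⟨ +-congˡ (Σ.sum-replicate-zero m) ⟩
    f t + 0#                                               ≈⟨ +-identityʳ (f t) ⟩
    f t                                                    ∎

  ∏-^ : ∀ {e} x (u : Fin e → ℕ) → ∏ F (λ k → x ^ u k) ≈ x ^ sumℕ u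
  ∏-^ x u = sym (foldFin-homo ℕ.+-0-monoid *-monoid ^-isMonoidHomomorphism u)
    where
    ^-isMonoidHomomorphism : MonoidMorphisms.IsMonoidHomomorphism ℕ.+-0-rawMonoid *-rawMonoid (x ^_)
    ^-isMonoidHomomorphism = record
      { isMagmaHomomorphism = record
        { isRelHomomorphism = record { cong = ^-congʳ x }
        ; homo = ^-homo-* x }
      ; ε-homo = refl }

  ∑Idx-cong : ∀ d {m} {f g : (Fin d → Fin m) → Carrier} → (∀ i → f i ≈ g i) → ∑Idx F d f ≈ ∑Idx F d g
  ∑Idx-cong zero    f≈g = f≈g _
  ∑Idx-cong (suc d) f≈g = ∑-cong (λ a → ∑Idx-cong d (λ i → f≈g (a ∷ᵥ i)))

  *-distribˡ-∑Idx : ∀ d {m} x (f : (Fin d → Fin m) → Carrier) → x * ∑Idx F d f ≈ ∑Idx F d (λ i → x * f i)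
  *-distribˡ-∑Idx zero    x f = refl
  *-distribˡ-∑Idx (suc d) x f =
    trans (*-distribˡ-∑ x (λ a → ∑Idx F d (λ i → f (a ∷ᵥ i))))
          (∑-cong (λ a → *-distribˡ-∑Idx d x (λ i → f (a ∷ᵥ i))))

  *-distribʳ-∑Idx : ∀ d {m} x (f : (Fin d → Fin m) → Carrier) → ∑Idx F d f * x ≈ ∑Idx F d (λ i → f i * x)
  *-distribʳ-∑Idx d x f = trans (*-comm _ x)
    (trans (*-distribˡ-∑Idx d x f) (∑Idx-cong d (λ i → *-comm x (f i))))

  ∑-∑Idx-comm : ∀ d {m n} (f : Fin n → (Fin d → Fin m) → Carrier) →
                ∑ F (λ a → ∑Idx F d (f a)) ≈ ∑Idx F d (λ i → ∑ F (λ a → f a i))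
  ∑-∑Idx-comm zero    f = refl
  ∑-∑Idx-comm (suc d) f =
    trans (∑-comm (λ a b → ∑Idx F d (λ i → f a (b ∷ᵥ i))))
          (∑-cong (λ b → ∑-∑Idx-comm d (λ a i → f a (b ∷ᵥ i))))

  ∑Idx-comm : ∀ d e {m n} (f : (Fin d → Fin m) → (Fin e → Fin n) → Carrier) →
              ∑Idx F d (λ i → ∑Idx F e (f i)) ≈ ∑Idx F e (λ u → ∑Idx F d (λ i → f i u))
  ∑Idx-comm zero    e f = refl
  ∑Idx-comm (suc d) e f =
    trans (∑-cong (λ a → ∑Idx-comm d e (λ i → f (a ∷ᵥ i))))
          (∑-∑Idx-comm e (λ a u → ∑Idx F d (λ i → f (a ∷ᵥ i) u)))

  ∏-∑-expand : ∀ e {m} (f : Fin e → Fin m → Carrier) →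
               ∏ F (λ k → ∑ F (f k)) ≈ ∑Idx F e (λ u → ∏ F (λ k → f k (u k)))
  ∏-∑-expand zero    f = refl
  ∏-∑-expand (suc e) f = begin
    ∑ F (f zero) * ∏ F (λ k → ∑ F (f (suc k)))         ≈⟨ *-congˡ (∏-∑-expand e (f ∘ suc)) ⟩
    ∑ F (f zero) * ∑Idx F e (λ u → ∏ F (λ k → f (suc k) (u k)))
      ≈⟨ *-distribʳ-∑ _ (f zero) ⟩
    ∑ F (λ a → f zero a * ∑Idx F e (λ u → ∏ F (λ k → f (suc k) (u k))))
      ≈⟨ ∑-cong (λ a → *-distribˡ-∑Idx e (f zero a) _) ⟩
    ∑Idx F (suc e) (λ u → ∏ F (λ k → f k (u k))) ∎

module _ {c₁ ℓ₁ c₂ ℓ₂} (F : Field c₁ ℓ₁) (G : Field c₂ ℓ₂) {φ : Field.Carrier F → Field.Carrier G}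
         (φ-hom : MonoidMorphisms.IsMonoidHomomorphism (Field.+-rawMonoid F) (Field.+-rawMonoid G) φ) where
  private
    module F = Field F
    module G = Field G

  ∑-homo : ∀ {m} (f : Vector F.Carrier m) → φ (∑ F f) G.≈ ∑ G (φ ∘ f)
  ∑-homo = foldFin-homo F.+-monoid G.+-monoid φ-hom

  ∑Idx-homo : ∀ d {m} (f : (Fin d → Fin m) → F.Carrier) → φ (∑Idx F d f) G.≈ ∑Idx G d (φ ∘ f)
  ∑Idx-homo zero    f = G.refl
  ∑Idx-homo (suc d) f = G.trans (∑-homo (λ a → ∑Idx F d (λ i → f (a ∷ᵥ i))))
                                (FieldSums.∑-cong G (λ a → ∑Idx-homo d (λ i → f (a ∷ᵥ i))))

module _ {c ℓ} (K : Field c ℓ) where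
  open Field K hiding (zero)
  open FieldSums K
  open SetoidReasoning setoid

  ⪯-trans : ∀ {d s m p} {S : Tensor K d s} {T : Tensor K d m} {U : Tensor K d p} →
            _⪯_ K S T → _⪯_ K T U → _⪯_ K S U
  ⪯-trans {d} {s} {m} {p} {S} {T} {U} (g , S≈gT) (h , T≈hU) = gh , λ j → begin
    S j                                                     ≈⟨ S≈gT j ⟩
    ∑Idx K d (λ i → G j i * T i)                            ≈⟨ ∑Idx-cong d (λ i → *-congˡ (T≈hU i)) ⟩
    ∑Idx K d (λ i → G j i * ∑Idx K d (λ u → H i u * U u))
      ≈⟨ ∑Idx-cong d (λ i → *-distribˡ-∑Idx d (G j i) _) ⟩
    ∑Idx K d (λ i → ∑Idx K d (λ u → G j i * (H i u * U u))) ≈⟨ ∑Idx-comm d d _ ⟩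
    ∑Idx K d (λ u → ∑Idx K d (λ i → G j i * (H i u * U u)))
      ≈⟨ ∑Idx-cong d (λ u → ∑Idx-cong d (λ i → *-assoc _ _ _)) ⟨
    ∑Idx K d (λ u → ∑Idx K d (λ i → (G j i * H i u) * U u))
      ≈⟨ ∑Idx-cong d (λ u → *-distribʳ-∑Idx d (U u) _) ⟨
    ∑Idx K d (λ u → ∑Idx K d (λ i → G j i * H i u) * U u)
      ≈⟨ ∑Idx-cong d (λ u → *-congʳ (∑Idx-cong d (λ i →
            ∏-distrib-* (λ k → g k (j k) (i k)) (λ k → h k (i k) (u k))))) ⟨
    ∑Idx K d (λ u → ∑Idx K d (λ i → ∏ K (λ k → g k (j k) (i k) * h k (i k) (u k))) * U u)
      ≈⟨ ∑Idx-cong d (λ u → *-congʳ (∏-∑-expand d (λ k a → g k (j k) a * h k a (u k)))) ⟨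
    ∑Idx K d (λ u → ∏ K (λ k → gh k (j k) (u k)) * U u)     ∎
    where
    G : (Fin d → Fin s) → (Fin d → Fin m) → Carrier
    G j i = ∏ K (λ k → g k (j k) (i k))
    H : (Fin d → Fin m) → (Fin d → Fin p) → Carrier
    H i u = ∏ K (λ k → h k (i k) (u k))
    gh : Fin d → Fin s → Fin p → Carrier
    gh k a b = ∑ K (λ x → g k a x * h k x b)

-- Linear algebra in an extension
module Coordinates {c ℓ c' ℓ'} {K : Field c ℓ} {m} (E : Extension K c' ℓ' m) where
  open Extension E public
  open IsRingHomomorphism ι-hom public
    using (+-homo; *-homo; 0#-homo; 1#-homo) renaming (⟦⟧-cong to ι-cong)
  module ΣK = FieldSums K
  module ΣL = FieldSums L
  open ΣL public using (_^_)
  private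
    module +L = GroupProperties L.+-group
    module Lp = CommutativeSemigroupProperties L.*-commutativeSemigroup
    module Kp = CommutativeSemigroupProperties K.*-commutativeSemigroup

  ι-∑ : ∀ {t} (f : Vector K.Carrier t) → ι (∑ K f) L.≈ ∑ L (ι ∘ f)
  ι-∑ = foldFin-homo K.+-monoid L.+-monoid (IsRingHomomorphism.+-isMonoidHomomorphism ι-hom)

  ι-∏ : ∀ {t} (f : Vector K.Carrier t) → ι (∏ K f) L.≈ ∏ L (ι ∘ f)
  ι-∏ = foldFin-homo K.*-monoid L.*-monoid (IsRingHomomorphism.*-isMonoidHomomorphism ι-hom)

  ι-δ : ∀ {t} (s i : Fin t) → ι (δ K s i) L.≈ δ L s i
  ι-δ s i with i ≟ s
  ... | yes _ = 1#-homo
  ... | no  _ = 0#-homo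

  lincomb : ∀ {t} → Vector L.Carrier t → Vector K.Carrier t → L.Carrier
  lincomb v cf = ∑ L (λ i → ι (cf i) L.* v i)

  Independent : ∀ {t} → Vector L.Carrier t → Set (c ⊔ ℓ ⊔ ℓ')
  Independent v = ∀ cf → lincomb v cf L.≈ L.0# → ∀ i → cf i K.≈ K.0#

  module _ {t} (v : Vector L.Carrier t) where
    lincomb-cong : ∀ {f g} → (∀ i → f i K.≈ g i) → lincomb v f L.≈ lincomb v g
    lincomb-cong f≈g = ΣL.∑-cong (λ i → L.*-congʳ (ι-cong (f≈g i)))

    lincomb-+ : ∀ f g → lincomb v (λ i → f i K.+ g i) L.≈ lincomb v f L.+ lincomb v g
    lincomb-+ f g = L.trans
      (ΣL.∑-cong (λ i → L.trans (L.*-congʳ (+-homo (f i) (g i))) (L.distribʳ (v i) _ _)))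
      (ΣL.∑-distrib-+ {t} _ _)

    lincomb-* : ∀ x f → lincomb v (λ i → x K.* f i) L.≈ ι x L.* lincomb v f
    lincomb-* x f = L.trans
      (ΣL.∑-cong (λ i → L.trans (L.*-congʳ (*-homo x (f i))) (L.*-assoc _ _ _)))
      (L.sym (ΣL.*-distribˡ-∑ {t} (ι x) _))

    lincomb-zero : lincomb v (λ _ → K.0#) L.≈ L.0#
    lincomb-zero = L.trans
      (ΣL.∑-cong (λ i → L.trans (L.*-congʳ 0#-homo) (L.zeroˡ (v i))))
      (ΣL.∑-zero t)

    lincomb-neg : ∀ f → lincomb v (λ i → K.- f i) L.≈ L.- lincomb v f
    lincomb-neg f = +L.inverseˡ-unique _ _ (begin
      lincomb v (λ i → K.- f i) L.+ lincomb v f   ≈⟨ lincomb-+ _ f ⟨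
      lincomb v (λ i → K.- f i K.+ f i)           ≈⟨ lincomb-cong (λ i → K.-‿inverseˡ (f i)) ⟩
      lincomb v (λ _ → K.0#)                      ≈⟨ lincomb-zero ⟩
      L.0#                                        ∎)
      where open SetoidReasoning L.setoid

    lincomb-injective : Independent v → ∀ f g → lincomb v f L.≈ lincomb v g → ∀ i → f i K.≈ g i
    lincomb-injective indep f g f≈g i = +K.x∙y⁻¹≈ε⇒x≈y (f i) (g i) (indep (λ i → f i K.- g i) (begin
      lincomb v (λ i → f i K.- g i)               ≈⟨ lincomb-+ f _ ⟩
      lincomb v f L.+ lincomb v (λ i → K.- g i)   ≈⟨ L.+-congˡ (lincomb-neg g) ⟩
      lincomb v f L.- lincomb v g                 ≈⟨ +L.x≈y⇒x∙y⁻¹≈ε f≈g ⟩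
      L.0#                                        ∎) i)
      where
      open SetoidReasoning L.setoid
      module +K = GroupProperties K.+-group

    lincomb-δ : ∀ s → lincomb v (δ K s) L.≈ v s
    lincomb-δ s = L.trans (ΣL.∑-cong (λ i → L.*-congʳ (ι-δ s i))) (ΣL.∑-select s v)

    lincomb-*ˡ : ∀ y f → lincomb (λ i → y L.* v i) f L.≈ y L.* lincomb v f
    lincomb-*ˡ y f = L.trans (ΣL.∑-cong (λ i → Lp.x∙yz≈y∙xz (ι (f i)) y (v i)))
                             (L.sym (ΣL.*-distribˡ-∑ {t} y _))

    lincomb-*ʳ : ∀ y f → lincomb (λ i → v i L.* y) f L.≈ lincomb v f L.* y
    lincomb-*ʳ y f = L.trans (ΣL.∑-cong (λ i → L.sym (L.*-assoc (ι (f i)) (v i) y)))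
                             (L.sym (ΣL.*-distribʳ-∑ {t} y _))

    lincomb-∑ : ∀ {s} (a : Vector K.Carrier s) (u : Fin s → Vector K.Carrier t) →
                ∑ L (λ j → ι (a j) L.* lincomb v (u j)) L.≈ lincomb v (λ i → ∑ K (λ j → a j K.* u j i))
    lincomb-∑ {s} a u = begin
      ∑ L (λ j → ι (a j) L.* lincomb v (u j))
        ≈⟨ ΣL.∑-cong (λ j → ΣL.*-distribˡ-∑ (ι (a j)) (λ i → ι (u j i) L.* v i)) ⟩
      ∑ L (λ j → ∑ L (λ i → ι (a j) L.* (ι (u j i) L.* v i)))
        ≈⟨ ΣL.∑-comm (λ j i → ι (a j) L.* (ι (u j i) L.* v i)) ⟩
      ∑ L (λ i → ∑ L (λ j → ι (a j) L.* (ι (u j i) L.* v i)))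
        ≈⟨ ΣL.∑-cong (λ i → ΣL.∑-cong (λ j →
              L.trans (L.sym (L.*-assoc _ _ _)) (L.*-congʳ (L.sym (*-homo (a j) (u j i)))))) ⟩
      ∑ L (λ i → ∑ L (λ j → ι (a j K.* u j i) L.* v i))
        ≈⟨ ΣL.∑-cong (λ i → ΣL.*-distribʳ-∑ (v i) (λ j → ι (a j K.* u j i))) ⟨
      ∑ L (λ i → ∑ L (λ j → ι (a j K.* u j i)) L.* v i)
        ≈⟨ ΣL.∑-cong (λ i → L.*-congʳ (ι-∑ (λ j → a j K.* u j i))) ⟨
      lincomb v (λ i → ∑ K (λ j → a j K.* u j i)) ∎
      where open SetoidReasoning L.setoid

    *-lincomb-closed : ∀ x → (∀ i → ∃ λ u → x L.* v i L.≈ lincomb v u) →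
                       ∀ w → ∃ λ w′ → x L.* lincomb v w L.≈ lincomb v w′
    *-lincomb-closed x closed w = _ , (begin
      x L.* lincomb v w                                    ≈⟨ ΣL.*-distribˡ-∑ x (λ i → ι (w i) L.* v i) ⟩
      ∑ L (λ i → x L.* (ι (w i) L.* v i))                  ≈⟨ ΣL.∑-cong (λ i → Lp.x∙yz≈y∙xz x (ι (w i)) (v i)) ⟩
      ∑ L (λ i → ι (w i) L.* (x L.* v i))                  ≈⟨ ΣL.∑-cong (λ i → L.*-congˡ (proj₂ (closed i))) ⟩
      ∑ L (λ i → ι (w i) L.* lincomb v (proj₁ (closed i))) ≈⟨ lincomb-∑ w (proj₁ ∘ closed) ⟩
      lincomb v (λ k → ∑ K (λ i → w i K.* proj₁ (closed i) k)) ∎)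
      where open SetoidReasoning L.setoid

  coord-spec : ∀ x → x L.≈ comb (coord x)
  coord-spec x = proj₂ (spanning x)

  coord-unique : ∀ {x f} → x L.≈ comb f → ∀ i → coord x i K.≈ f i
  coord-unique {x} {f} x≈f = lincomb-injective basis independent (coord x) f (L.trans (L.sym (coord-spec x)) x≈f)

  coord-cong : ∀ {x y} → x L.≈ y → ∀ i → coord x i K.≈ coord y i
  coord-cong {x} {y} x≈y = coord-unique (L.trans x≈y (coord-spec y))

  coord-ι* : ∀ a x i → coord (ι a L.* x) i K.≈ a K.* coord x i
  coord-ι* a x = coord-unique (L.trans (L.*-congˡ (coord-spec x)) (L.sym (lincomb-* basis a (coord x))))

  coord-basis : ∀ s i → coord (basis s) i K.≈ δ K s i
  coord-basis s = coord-unique (L.sym (lincomb-δ basis s))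

  coord-+ : ∀ x y i → coord (x L.+ y) i K.≈ coord x i K.+ coord y i
  coord-+ x y = coord-unique (L.trans (L.+-cong (coord-spec x) (coord-spec y))
                                      (L.sym (lincomb-+ basis (coord x) (coord y))))

  coord-0# : ∀ i → coord L.0# i K.≈ K.0#
  coord-0# = coord-unique (L.sym (lincomb-zero basis))

  coord-isMonoidHomomorphism : ∀ i → MonoidMorphisms.IsMonoidHomomorphism L.+-rawMonoid K.+-rawMonoid (λ x → coord x i)
  coord-isMonoidHomomorphism i = record
    { isMagmaHomomorphism = record
      { isRelHomomorphism = record { cong = λ x≈y → coord-cong x≈y i }
      ; homo = λ x y → coord-+ x y i }
    ; ε-homo = coord-0# i }

  coord-lincomb : ∀ {t} (w : Vector L.Carrier t) f i → coord (lincomb w f) i K.≈ ∑ K (λ a → f a K.* coord (w a) i)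
  coord-lincomb w f i = K.trans (∑-homo L K (coord-isMonoidHomomorphism i) (λ a → ι (f a) L.* w a))
                                (ΣK.∑-cong (λ a → coord-ι* (f a) (w a) i))

  powers : ∀ t → L.Carrier → Vector L.Carrier t
  powers t x i = x ^ toℕ i

  ∏-lincomb-powers : ∀ e {t} x (c : Fin e → Fin t → K.Carrier) →
    ∏ L (λ k → lincomb (powers t x) (c k))
      L.≈ ∑Idx L e (λ u → ι (∏ K (λ k → c k (u k))) L.* x ^ sumℕ (toℕ ∘ u))
  ∏-lincomb-powers e {t} x c = begin
    ∏ L (λ k → lincomb (powers t x) (c k))
      ≈⟨ ΣL.∏-∑-expand e (λ k i → ι (c k i) L.* x ^ toℕ i) ⟩
    ∑Idx L e (λ u → ∏ L (λ k → ι (c k (u k)) L.* x ^ toℕ (u k)))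
      ≈⟨ ΣL.∑Idx-cong e (λ u → ΣL.∏-distrib-* (λ k → ι (c k (u k))) (λ k → x ^ toℕ (u k))) ⟩
    ∑Idx L e (λ u → ∏ L (λ k → ι (c k (u k))) L.* ∏ L (λ k → x ^ toℕ (u k)))
      ≈⟨ ΣL.∑Idx-cong e (λ u → L.*-cong (L.sym (ι-∏ (λ k → c k (u k)))) (ΣL.∏-^ x (toℕ ∘ u))) ⟩
    ∑Idx L e (λ u → ι (∏ K (λ k → c k (u k))) L.* x ^ sumℕ (toℕ ∘ u)) ∎
    where open SetoidReasoning L.setoid

  Spans : ∀ {t} → Vector L.Carrier t → Set (c ⊔ c' ⊔ ℓ')
  Spans v = ∀ x → ∃ λ cf → x L.≈ lincomb v cf

  record PowerBasis (α : L.Carrier) : Set (c ⊔ ℓ ⊔ c' ⊔ ℓ') where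
    field
      powers-span        : Spans (powers m α)
      powers-independent : Independent (powers m α)

  withPowerBasis : ∀ α → PowerBasis α → Extension K c' ℓ' m
  withPowerBasis α α-basis = record
    { L = L ; ι = ι ; ι-hom = ι-hom ; basis = powers m α
    ; spanning = PowerBasis.powers-span α-basis ; independent = PowerBasis.powers-independent α-basis }

  ∑-coord-lincomb : ∀ {s} (a : Vector K.Carrier s) (x : Vector L.Carrier s) (g : Vector K.Carrier m) →
    ∑ K (λ j → a j K.* ∑ K (λ i → g i K.* coord (x j) i)) K.≈ ∑ K (λ i → g i K.* coord (lincomb x a) i)
  ∑-coord-lincomb a x g = begin
    ∑ K (λ j → a j K.* ∑ K (λ i → g i K.* coord (x j) i))
      ≈⟨ ΣK.∑-cong (λ j → ΣK.*-distribˡ-∑ (a j) (λ i → g i K.* coord (x j) i)) ⟩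
    ∑ K (λ j → ∑ K (λ i → a j K.* (g i K.* coord (x j) i)))
      ≈⟨ ΣK.∑-comm (λ j i → a j K.* (g i K.* coord (x j) i)) ⟩
    ∑ K (λ i → ∑ K (λ j → a j K.* (g i K.* coord (x j) i)))
      ≈⟨ ΣK.∑-cong (λ i → ΣK.∑-cong (λ j → Kp.x∙yz≈y∙xz (a j) (g i) _)) ⟩
    ∑ K (λ i → ∑ K (λ j → g i K.* (a j K.* coord (x j) i)))
      ≈⟨ ΣK.∑-cong (λ i → ΣK.*-distribˡ-∑ (g i) (λ j → a j K.* coord (x j) i)) ⟨
    ∑ K (λ i → g i K.* ∑ K (λ j → a j K.* coord (x j) i))
      ≈⟨ ΣK.∑-cong (λ i → K.*-congˡ (coord-lincomb x a i)) ⟨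
    ∑ K (λ i → g i K.* coord (lincomb x a) i) ∎
    where open SetoidReasoning K.setoid

  monomial : ∀ {e} → (Fin (suc e) → Fin m) → L.Carrier
  monomial i = ∏ L (λ k → basis (i (inject₁ k)))

  structTensor-contract-scaled : ∀ e z (G : Fin (suc e) → Fin m → K.Carrier) →
    ∑Idx K (suc e) (λ i → ∏ K (λ k → G k (i k)) K.* coord (z L.* monomial i) (i (fromℕ e)))
      K.≈ ∑ K (λ a → G (fromℕ e) a K.* coord (z L.* ∏ L (λ k → comb (G (inject₁ k)))) a)
  structTensor-contract-scaled zero    z G = ΣK.∑-cong {m} (λ a → K.*-congʳ (K.*-identityʳ (G zero a)))
  structTensor-contract-scaled (suc e) z G = begin
    ∑ K (λ a → ∑Idx K (suc e) (λ i → (G zero a K.* ∏ K (λ k → G (suc k) (i k)))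
                                       K.* coord (z L.* (basis a L.* monomial i)) (i (fromℕ e))))
      ≈⟨ ΣK.∑-cong {m} (λ a → ΣK.∑Idx-cong (suc e) {m} (λ i →
            K.trans (K.*-assoc (G zero a) (∏ K (λ k → G (suc k) (i k))) _)
              (K.*-congˡ (K.*-congˡ (coord-cong (L.sym (L.*-assoc z (basis a) (monomial i))) (i (fromℕ e))))))) ⟩
    ∑ K (λ a → ∑Idx K (suc e) (λ i → G zero a K.* (∏ K (λ k → G (suc k) (i k))
                                       K.* coord ((z L.* basis a) L.* monomial i) (i (fromℕ e)))))
      ≈⟨ ΣK.∑-cong {m} (λ a → ΣK.*-distribˡ-∑Idx (suc e) {m} (G zero a)
                 (λ i → ∏ K (λ k → G (suc k) (i k)) K.* coord ((z L.* basis a) L.* monomial i) (i (fromℕ e)))) ⟨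
    ∑ K (λ a → G zero a K.* ∑Idx K (suc e) (λ i → ∏ K (λ k → G (suc k) (i k))
                                       K.* coord ((z L.* basis a) L.* monomial i) (i (fromℕ e))))
      ≈⟨ ΣK.∑-cong {m} (λ a → K.*-congˡ (structTensor-contract-scaled e (z L.* basis a) (G ∘ suc))) ⟩
    ∑ K (λ a → G zero a K.* ∑ K (λ b → Gₗ b K.* coord ((z L.* basis a) L.* Q) b))
      ≈⟨ ∑-coord-lincomb (G zero) (λ a → (z L.* basis a) L.* Q) Gₗ ⟩
    ∑ K (λ b → Gₗ b K.* coord (lincomb (λ a → (z L.* basis a) L.* Q) (G zero)) b)
      ≈⟨ ΣK.∑-cong {m} (λ b → K.*-congˡ (coord-cong expand-first b)) ⟩
    ∑ K (λ b → Gₗ b K.* coord (z L.* (comb (G zero) L.* Q)) b) ∎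
    where
    open SetoidReasoning K.setoid
    Gₗ : Fin m → K.Carrier
    Gₗ = G (fromℕ (suc e))
    Q : L.Carrier
    Q = ∏ L (λ k → comb (G (suc (inject₁ k))))
    expand-first : lincomb (λ a → (z L.* basis a) L.* Q) (G zero) L.≈ z L.* (comb (G zero) L.* Q)
    expand-first = L.trans (lincomb-*ʳ (λ a → z L.* basis a) Q (G zero))
                           (L.trans (L.*-congʳ (lincomb-*ˡ basis z (G zero))) (L.*-assoc z _ Q))

  structTensor-contract : ∀ e (G : Fin (suc e) → Fin m → K.Carrier) →
    ∑Idx K (suc e) (λ i → ∏ K (λ k → G k (i k)) K.* structTensor E (suc e) i)
      K.≈ ∑ K (λ a → G (fromℕ e) a K.* coord (∏ L (λ k → comb (G (inject₁ k)))) a)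
  structTensor-contract e G = begin
    ∑Idx K (suc e) (λ i → ∏ K (λ k → G k (i k)) K.* coord (monomial i) (i (fromℕ e)))
      ≈⟨ ΣK.∑Idx-cong (suc e) {m} (λ i →
            K.*-congˡ {∏ K (λ k → G k (i k))} (coord-cong (L.*-identityˡ (monomial i)) (i (fromℕ e)))) ⟨
    ∑Idx K (suc e) (λ i → ∏ K (λ k → G k (i k)) K.* coord (L.1# L.* monomial i) (i (fromℕ e)))
      ≈⟨ structTensor-contract-scaled e L.1# G ⟩
    ∑ K (λ a → G (fromℕ e) a K.* coord (L.1# L.* ∏ L (λ k → comb (G (inject₁ k)))) a)
      ≈⟨ ΣK.∑-cong {m} (λ a → K.*-congˡ (coord-cong (L.*-identityˡ _) a)) ⟩
    ∑ K (λ a → G (fromℕ e) a K.* coord (∏ L (λ k → comb (G (inject₁ k)))) a) ∎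
    where open SetoidReasoning K.setoid

-- Restrictions between structure tensors
infixl 5 _∷ʳ_
_∷ʳ_ : ∀ {a} {A : Set a} {n} → Vector A n → A → Vector A (suc n)
_∷ʳ_ {n = zero}  xs y _       = y
_∷ʳ_ {n = suc n} xs y zero    = xs zero
_∷ʳ_ {n = suc n} xs y (suc i) = (xs ∘ suc ∷ʳ y) i

init-∷ʳ : ∀ {a} {A : Set a} {n} (xs : Vector A n) y i → (xs ∷ʳ y) (inject₁ i) ≡ xs i
init-∷ʳ {n = suc n} xs y zero    = ≡.refl
init-∷ʳ {n = suc n} xs y (suc i) = init-∷ʳ (xs ∘ suc) y i

last-∷ʳ : ∀ {a} {A : Set a} {n} (xs : Vector A n) y → (xs ∷ʳ y) (fromℕ n) ≡ y
last-∷ʳ {n = zero}  xs y = ≡.refl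
last-∷ʳ {n = suc n} xs y = last-∷ʳ (xs ∘ suc) y

module _ {c ℓ c₁ ℓ₁ c₂ ℓ₂} {K : Field c ℓ} {n l}
         (E : Extension K c₁ ℓ₁ n) (E′ : Extension K c₂ ℓ₂ l) where
  private
    module E = Coordinates E
    module E′ = Coordinates E′
    open Field K using (_≈_; _*_; *-comm; *-cong)
    open SetoidReasoning (Field.setoid K)

  structTensor-⪯ : ∀ e (A : E.L.Carrier → E′.L.Carrier) (w : Fin l → E.L.Carrier) →
    (∀ (y : Fin e → E.L.Carrier) → E.lincomb w (E′.coord (∏ E′.L (A ∘ y))) E.L.≈ ∏ E.L y) →
    _⪯_ K (structTensor E (suc e)) (structTensor E′ (suc e))
  structTensor-⪯ e A w section = g , λ j → begin
    E.coord (∏ E.L (λ k → E.basis (j (inject₁ k)))) (j (fromℕ e))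
      ≈⟨ E.coord-cong (section (λ k → E.basis (j (inject₁ k)))) (j (fromℕ e)) ⟨
    E.coord (E.lincomb w (E′.coord (X j))) (j (fromℕ e))
      ≈⟨ E.coord-lincomb w (E′.coord (X j)) (j (fromℕ e)) ⟩
    ∑ K (λ a → E′.coord (X j) a * E.coord (w a) (j (fromℕ e)))
      ≈⟨ E.ΣK.∑-cong {l} (λ a → E.K.trans (*-comm _ _) (*-cong (out≡ j a) (E′.coord-cong (X≈ j) a))) ⟩
    ∑ K (λ a → g (fromℕ e) (j (fromℕ e)) a
                * E′.coord (∏ E′.L (λ k → E′.comb (g (inject₁ k) (j (inject₁ k))))) a)
      ≈⟨ E′.structTensor-contract e (λ k → g k (j k)) ⟨
    ∑Idx K (suc e) (λ i → ∏ K (λ k → g k (j k) (i k)) * structTensor E′ (suc e) i) ∎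
    where
    input : Fin n → Fin l → Field.Carrier K
    input b = E′.coord (A (E.basis b))
    output : Fin n → Fin l → Field.Carrier K
    output b a = E.coord (w a) b
    g : Fin (suc e) → Fin n → Fin l → Field.Carrier K
    g = (λ _ → input) ∷ʳ output
    X : (Fin (suc e) → Fin n) → E′.L.Carrier
    X j = ∏ E′.L (λ k → A (E.basis (j (inject₁ k))))
    out≡ : ∀ j a → E.coord (w a) (j (fromℕ e)) ≈ g (fromℕ e) (j (fromℕ e)) a
    out≡ j a = E.K.reflexive (≡.cong (λ h → h (j (fromℕ e)) a) (≡.sym (last-∷ʳ {n = e} (λ _ → input) output)))
    X≈ : ∀ j → X j E′.L.≈ ∏ E′.L (λ k → E′.comb (g (inject₁ k) (j (inject₁ k))))
    X≈ j = E′.ΣL.∏-cong (λ k → E′.L.trans (E′.coord-spec _)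
             (E′.L.reflexive (≡.cong (λ h → E′.comb (h (j (inject₁ k)))) (≡.sym (init-∷ʳ (λ _ → input) output k)))))

module _ {c ℓ c′ ℓ′} {K : Field c ℓ} {m} (E : Extension K c′ ℓ′ m)
         {α} (α-basis : Coordinates.PowerBasis E α) where
  private
    module E = Coordinates E
    module P = Coordinates (E.withPowerBasis α α-basis)

  ⪯-withPowerBasis : ∀ e → _⪯_ K (structTensor E (suc e)) (structTensor (E.withPowerBasis α α-basis) (suc e))
  ⪯-withPowerBasis e = structTensor-⪯ E (E.withPowerBasis α α-basis) e id (E.powers m α)
    (λ y → E.L.sym (P.coord-spec (∏ E.L y)))

  withPowerBasis-⪯ : ∀ e → _⪯_ K (structTensor (E.withPowerBasis α α-basis) (suc e)) (structTensor E (suc e))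
  withPowerBasis-⪯ e = structTensor-⪯ (E.withPowerBasis α α-basis) E e id E.basis
    (λ y → E.L.sym (E.coord-spec (∏ E.L y)))

sumℕ-≤ : ∀ {e} (f : Vector ℕ e) {b} → (∀ k → f k ≤ b) → sumℕ f ≤ e ℕ.* b
sumℕ-≤ {zero}  f f≤b = z≤n
sumℕ-≤ {suc e} f f≤b = ℕ.+-mono-≤ (f≤b zero) (sumℕ-≤ (f ∘ suc) (f≤b ∘ suc))

toℕ≤n∸1 : ∀ {n} (i : Fin n) → toℕ i ≤ n ∸ 1
toℕ≤n∸1 {suc n} i = toℕ≤pred[n] i

module _ {c ℓ c₁ ℓ₁ c₂ ℓ₂} {K : Field c ℓ} {n l}
         {En : Extension K c₁ ℓ₁ n} {El : Extension K c₂ ℓ₂ l} {β α}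
         (β-basis : Coordinates.PowerBasis En β) (α-basis : Coordinates.PowerBasis El α) where
  private
    module N = Coordinates (Coordinates.withPowerBasis En β β-basis)
    module M = Coordinates (Coordinates.withPowerBasis El α α-basis)

  lift : N.L.Carrier → M.L.Carrier
  lift y = M.lincomb (M.powers n α) (N.coord y)

  reduce : M.L.Carrier → N.L.Carrier
  reduce Y = N.lincomb (N.powers l β) (M.coord Y)

  reduce-isMonoidHomomorphism : MonoidMorphisms.IsMonoidHomomorphism M.L.+-rawMonoid N.L.+-rawMonoid reduce
  reduce-isMonoidHomomorphism = record
    { isMagmaHomomorphism = record
      { isRelHomomorphism = record { cong = λ Y≈Z → N.lincomb-cong (N.powers l β) (M.coord-cong Y≈Z) }
      ; homo = λ Y Z → N.L.trans (N.lincomb-cong (N.powers l β) (M.coord-+ Y Z))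
                                 (N.lincomb-+ (N.powers l β) (M.coord Y) (M.coord Z)) }
    ; ε-homo = N.L.trans (N.lincomb-cong (N.powers l β) M.coord-0#) (N.lincomb-zero (N.powers l β)) }

  reduce-ι* : ∀ a Y → reduce (M.ι a M.L.* Y) N.L.≈ N.ι a N.L.* reduce Y
  reduce-ι* a Y = N.L.trans (N.lincomb-cong (N.powers l β) (M.coord-ι* a Y))
                            (N.lincomb-* (N.powers l β) a (M.coord Y))

  reduce-^ : ∀ {t} → t < l → reduce (α M.^ t) N.L.≈ β N.^ t
  reduce-^ {t} t<l = begin
    reduce (α M.^ t)                           ≡⟨ ≡.cong (λ s → reduce (α M.^ s)) (toℕ-fromℕ< t<l) ⟨
    reduce (M.basis i)                         ≈⟨ N.lincomb-cong (N.powers l β) (M.coord-basis i) ⟩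
    N.lincomb (N.powers l β) (δ K i)           ≈⟨ N.lincomb-δ (N.powers l β) i ⟩
    β N.^ toℕ i                                ≡⟨ ≡.cong (β N.^_) (toℕ-fromℕ< t<l) ⟩
    β N.^ t                                    ∎
    where
    open SetoidReasoning N.L.setoid
    i : Fin l
    i = fromℕ< t<l

  reduce-∏-lift : ∀ e → e ℕ.* (n ∸ 1) < l → ∀ (y : Fin e → N.L.Carrier) →
                  reduce (∏ M.L (lift ∘ y)) N.L.≈ ∏ N.L y
  reduce-∏-lift e e[n-1]<l y = begin
    reduce (∏ M.L (lift ∘ y))
      ≈⟨ N.lincomb-cong (N.powers l β) (M.coord-cong (M.∏-lincomb-powers e α γ)) ⟩
    reduce (∑Idx M.L e (λ u → M.ι (∏ K (λ k → γ k (u k))) M.L.* α M.^ sumℕ (toℕ ∘ u)))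
      ≈⟨ ∑Idx-homo M.L N.L reduce-isMonoidHomomorphism e _ ⟩
    ∑Idx N.L e (λ u → reduce (M.ι (∏ K (λ k → γ k (u k))) M.L.* α M.^ sumℕ (toℕ ∘ u)))
      ≈⟨ N.ΣL.∑Idx-cong e (λ u → N.L.trans (reduce-ι* _ _) (N.L.*-congˡ (reduce-^ (degree<l u)))) ⟩
    ∑Idx N.L e (λ u → N.ι (∏ K (λ k → γ k (u k))) N.L.* β N.^ sumℕ (toℕ ∘ u))
      ≈⟨ N.∏-lincomb-powers e β γ ⟨
    ∏ N.L (λ k → N.comb (γ k))
      ≈⟨ N.ΣL.∏-cong (λ k → N.coord-spec (y k)) ⟨
    ∏ N.L y ∎
    where
    open SetoidReasoning N.L.setoid
    γ : Fin e → Fin n → Field.Carrier K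
    γ k = N.coord (y k)
    degree<l : ∀ (u : Fin e → Fin n) → sumℕ (toℕ ∘ u) < l
    degree<l u = ℕ.≤-<-trans (sumℕ-≤ (toℕ ∘ u) (toℕ≤n∸1 ∘ u)) e[n-1]<l

  powerBasis-⪯ : ∀ e → e ℕ.* (n ∸ 1) < l →
    _⪯_ K (structTensor (Coordinates.withPowerBasis En β β-basis) (suc e))
          (structTensor (Coordinates.withPowerBasis El α α-basis) (suc e))
  powerBasis-⪯ e e[n-1]<l =
    structTensor-⪯ (Coordinates.withPowerBasis En β β-basis) (Coordinates.withPowerBasis El α α-basis)
                   e lift (N.powers l β) (reduce-∏-lift e e[n-1]<l)

-- Lists without repetitions
length-cartesianProductWith : ∀ {a b c} {A : Set a} {B : Set b} {C : Set c} (f : A → B → C) xs ys →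
  length (List.cartesianProductWith f xs ys) ≡ length xs ℕ.* length ys
length-cartesianProductWith f []       ys = ≡.refl
length-cartesianProductWith f (x ∷ xs) ys = ≡.trans (length-++ (List.map (f x) ys))
  (≡.cong₂ ℕ._+_ (length-map (f x) ys) (length-cartesianProductWith f xs ys))

length-filter-∁ : ∀ {a p} {A : Set a} {P : A → Set p} (P? : Decidable₁ P) xs →
                  length (List.filter P? xs) ℕ.+ length (List.filter (∁? P?) xs) ≡ length xs
length-filter-∁ P? []       = ≡.refl
length-filter-∁ P? (x ∷ xs) with P? x
... | yes _ = ≡.cong suc (length-filter-∁ P? xs)
... | no  _ = ≡.trans (ℕ.+-suc _ _) (≡.cong suc (length-filter-∁ P? xs))

module UniqueList {a ℓ} (S : Setoid a ℓ) where
  open Setoid S renaming (Carrier to A)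
  open import Data.List.Membership.Setoid S public using (_∈_; _∉_; _─_)
  open import Data.List.Membership.Setoid.Properties using (∈-resp-≈; All[≉]⇒∉)
  open import Data.List.Relation.Unary.Unique.Setoid S public using (Unique)

  ∈-─ : ∀ {x y xs} (p : x ∈ xs) → y ∈ xs → ¬ y ≈ x → y ∈ xs ─ p
  ∈-─ (here x≈z) (here y≈z) y≉x = contradiction (trans y≈z (sym x≈z)) y≉x
  ∈-─ (here _)   (there y∈) _   = y∈
  ∈-─ (there p)  (here y≈z) _   = here y≈z
  ∈-─ (there p)  (there y∈) y≉x = there (∈-─ p y∈ y≉x)

  ∈-head-fresh : ∀ {x y xs} → Unique (x ∷ xs) → y ∈ xs → ¬ y ≈ x
  ∈-head-fresh (x≉xs ∷ _) y∈xs y≈x = All[≉]⇒∉ S x≉xs (∈-resp-≈ S y≈x y∈xs)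

  ─-⊆ : ∀ {x y xs} (p : x ∈ xs) → y ∈ xs ─ p → y ∈ xs
  ─-⊆ (here _)  y∈       = there y∈
  ─-⊆ (there p) (here y≈) = here y≈
  ─-⊆ (there p) (there y∈) = there (─-⊆ p y∈)

  ∈-─⇒≉ : ∀ {x y xs} → Unique xs → (p : x ∈ xs) → y ∈ xs ─ p → ¬ y ≈ x
  ∈-─⇒≉ u (here x≈z) y∈ y≈x = ∈-head-fresh u y∈ (trans y≈x x≈z)
  ∈-─⇒≉ u@(_ ∷ u′) (there p) (here y≈z) y≈x = ∈-head-fresh u p (trans (sym y≈x) y≈z)
  ∈-─⇒≉ (_ ∷ u′) (there p) (there y∈) = ∈-─⇒≉ u′ p y∈

  Unique-─ : ∀ {x xs} → Unique xs → (p : x ∈ xs) → Unique (xs ─ p)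
  Unique-─ (_   ∷ u) (here _)  = u
  Unique-─ (x≉ ∷ u) (there p) = AllProperties.─⁺ p x≉ ∷ Unique-─ u p

  ⊆⇒length≤ : ∀ {xs ys} → Unique xs → (∀ {y} → y ∈ xs → y ∈ ys) → length xs ≤ length ys
  ⊆⇒length≤ {[]}     _               _     = z≤n
  ⊆⇒length≤ {x ∷ xs} {ys} u@(_ ∷ uxs) xs⊆ys =
    ≡.subst (suc (length xs) ≤_) (≡.sym (length-removeAt′ ys (Any.index x∈ys)))
      (s≤s (⊆⇒length≤ uxs (λ y∈xs → ∈-─ x∈ys (xs⊆ys (there y∈xs)) (∈-head-fresh u y∈xs))))
    where
    x∈ys : x ∈ ys
    x∈ys = xs⊆ys (here refl)

module _ {a ℓ} (M : CommutativeMonoid a ℓ) where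
  open CommutativeMonoid M
  open UniqueList setoid
  private
    ∏ᴸ : List Carrier → Carrier
    ∏ᴸ = List.foldr _∙_ ε

  foldr-─ : ∀ {x xs} (p : x ∈ xs) → ∏ᴸ xs ≈ x ∙ ∏ᴸ (xs ─ p)
  foldr-─ (here x≈y)  = ∙-congʳ (sym x≈y)
  foldr-─ (there p)   = trans (∙-congˡ (foldr-─ p)) (CSP.x∙yz≈y∙xz _ _ _)
    where module CSP = CommutativeSemigroupProperties commutativeSemigroup

  foldr-⊆ : ∀ {xs ys} → Unique ys → length xs ≡ length ys → (∀ {y} → y ∈ ys → y ∈ xs) → ∏ᴸ xs ≈ ∏ᴸ ys
  foldr-⊆ {[]}     {[]}     _ _ _ = refl
  foldr-⊆ {xs} {y ∷ ys} u@(_ ∷ uys) |xs|≡|ys| ys⊆xs =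
    trans (foldr-─ y∈xs)
      (∙-congˡ (foldr-⊆ uys (ℕ.suc-injective (≡.trans (≡.sym (length-removeAt′ xs (Any.index y∈xs))) |xs|≡|ys|))
                        (λ z∈ys → ∈-─ y∈xs (ys⊆xs (there z∈ys)) (∈-head-fresh u z∈ys))))
    where
    y∈xs : y ∈ xs
    y∈xs = ys⊆xs (here refl)

module VectorEnumeration {a ℓ} (S : Setoid a ℓ) where
  open Setoid S renaming (Carrier to A)
  open UniqueList S using (_∈_; Unique)
  private
    module V {t} = UniqueList (≋-setoid S t)

  vectors : List A → ∀ t → List (Vector A t)
  vectors xs zero    = List.[ (λ ()) ]
  vectors xs (suc t) = List.cartesianProductWith _∷ᵥ_ xs (vectors xs t)

  length-vectors : ∀ xs t → length (vectors xs t) ≡ length xs ℕ.^ t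
  length-vectors xs zero    = ≡.refl
  length-vectors xs (suc t) = ≡.trans (length-cartesianProductWith _∷ᵥ_ xs (vectors xs t))
                                      (≡.cong (length xs ℕ.*_) (length-vectors xs t))

  vectors-unique : ∀ {xs} → Unique xs → ∀ t → V.Unique (vectors xs t)
  vectors-unique u zero    = [] ∷ []
  vectors-unique u (suc t) = UniqueProperties.cartesianProductWith⁺ S (≋-setoid S t) (≋-setoid S (suc t))
    _∷ᵥ_ (λ x∷v≋y∷w → x∷v≋y∷w zero , x∷v≋y∷w ∘ suc) u (vectors-unique u t)

  vectors-complete : ∀ {xs} → (∀ x → x ∈ xs) → ∀ t (v : Vector A t) → v V.∈ vectors xs t
  vectors-complete all∈ zero    v = here (λ ())
  vectors-complete all∈ (suc t) v =
    MembershipProperties.∈-resp-≈ (≋-setoid S (suc t)) (λ { zero → refl ; (suc i) → refl })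
      (MembershipProperties.∈-cartesianProductWith⁺ S (≋-setoid S t) (≋-setoid S (suc t))
        (λ x≈y v≋w → λ { zero → x≈y ; (suc i) → v≋w i }) (all∈ (v zero)) (vectors-complete all∈ t (v ∘ suc)))

-- Counting roots in a field
2≤^suc : ∀ {q} → 2 ≤ q → ∀ M → 2 ≤ q ℕ.^ suc M
2≤^suc 2≤q M = ℕ.≤-trans (ℕ.*-monoʳ-≤ 2 (ℕ.m^n>0 2 M)) (ℕ.^-monoˡ-≤ (suc M) 2≤q)

geometricSum : ℕ → ℕ → ℕ
geometricSum q zero    = 0
geometricSum q (suc M) = q ℕ.^ suc M ℕ.+ geometricSum q M

geometricSum<^suc : ∀ {q} → 2 ≤ q → ∀ M → geometricSum q M < q ℕ.^ suc M
geometricSum<^suc {q} 2≤q M = ℕ.<-≤-trans (ℕ.m<m+n (geometricSum q M) (ℕ.≤-trans (s≤s z≤n) 2≤q)) (+q≤ M)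
  where
  open ℕ.≤-Reasoning
  +q≤ : ∀ M → geometricSum q M ℕ.+ q ≤ q ℕ.^ suc M
  +q≤ zero    = ℕ.≤-reflexive (≡.sym (ℕ.*-identityʳ q))
  +q≤ (suc M) = begin
    (q ℕ.^ suc M ℕ.+ geometricSum q M) ℕ.+ q   ≡⟨ ℕ.+-assoc (q ℕ.^ suc M) _ q ⟩
    q ℕ.^ suc M ℕ.+ (geometricSum q M ℕ.+ q)   ≤⟨ ℕ.+-monoʳ-≤ (q ℕ.^ suc M) (+q≤ M) ⟩
    q ℕ.^ suc M ℕ.+ q ℕ.^ suc M                ≡⟨ ≡.cong (q ℕ.^ suc M ℕ.+_) (ℕ.+-identityʳ (q ℕ.^ suc M)) ⟨
    2 ℕ.* q ℕ.^ suc M                          ≤⟨ ℕ.*-monoˡ-≤ (q ℕ.^ suc M) 2≤q ⟩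
    q ℕ.^ suc (suc M)                          ∎

module MonicPolynomials {c ℓ} (F : Field c ℓ) where
  open Field F hiding (zero)
  open UniqueList setoid
  open FieldSums F using (_^_)
  open RingProperties ring using (-‿distribʳ-*)
  open NaturalSolver commutativeSemiring using (solve; _:=_; _:+_; _:*_; con)
  open SetoidReasoning setoid

  evalMonic : List Carrier → Carrier → Carrier
  evalMonic []       x = 1#
  evalMonic (a ∷ as) x = a + x * evalMonic as x

  divideMonic : Carrier → List Carrier → List Carrier
  divideMonic r []       = []
  divideMonic r (b ∷ bs) = evalMonic (b ∷ bs) r ∷ divideMonic r bs

  length-divideMonic : ∀ r as → length (divideMonic r as) ≡ length as
  length-divideMonic r []       = ≡.refl
  length-divideMonic r (b ∷ bs) = ≡.cong suc (length-divideMonic r bs)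

  x-r+r≈x : ∀ x r → (x - r) + r ≈ x
  x-r+r≈x x r = trans (+-assoc x (- r) r) (trans (+-congˡ (-‿inverseˡ r)) (+-identityʳ x))

  -- x is written as (x - r) + r so that the semiring solver, which knows no subtraction,
  -- can treat x - r as an atom.
  evalMonic-divide : ∀ r a as x →
    evalMonic (a ∷ as) x ≈ (x - r) * evalMonic (divideMonic r as) x + evalMonic (a ∷ as) r
  evalMonic-divide r a []       x = begin
    a + x * 1#                                ≈⟨ +-congˡ (*-congʳ (x-r+r≈x x r)) ⟨
    a + ((x - r) + r) * 1#                    ≈⟨ solve 3 (λ a y r → a :+ (y :+ r) :* con 1
                                                          := y :* con 1 :+ (a :+ r :* con 1)) refl a (x - r) r ⟩
    (x - r) * 1# + (a + r * 1#)               ∎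
  evalMonic-divide r a (b ∷ bs) x = begin
    a + x * evalMonic (b ∷ bs) x              ≈⟨ +-congˡ (*-cong (x-r+r≈x x r) (sym (evalMonic-divide r b bs x))) ⟨
    a + ((x - r) + r) * ((x - r) * Q + P)     ≈⟨ solve 5 (λ a y r Q P → a :+ (y :+ r) :* (y :* Q :+ P)
                                                          := y :* (P :+ (y :+ r) :* Q) :+ (a :+ r :* P))
                                                   refl a (x - r) r Q P ⟩
    (x - r) * (P + ((x - r) + r) * Q) + (a + r * P)
                                              ≈⟨ +-congʳ (*-congˡ (+-congˡ (*-congʳ (x-r+r≈x x r)))) ⟩
    (x - r) * (P + x * Q) + (a + r * P)       ∎
    where
    Q P : Carrier
    Q = evalMonic (divideMonic r bs) x
    P = evalMonic (b ∷ bs) r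

  *-cancelˡ-nonzero : ∀ {x y z} → ¬ x ≈ 0# → x * y ≈ x * z → y ≈ z
  *-cancelˡ-nonzero {x} {y} {z} x≉0 xy≈xz with inverse x x≉0
  ... | x⁻¹ , xx⁻¹≈1 = begin
    y                ≈⟨ *-identityˡ y ⟨
    1# * y           ≈⟨ *-congʳ (trans (*-comm x⁻¹ x) xx⁻¹≈1) ⟨
    (x⁻¹ * x) * y    ≈⟨ *-assoc x⁻¹ x y ⟩
    x⁻¹ * (x * y)    ≈⟨ *-congˡ xy≈xz ⟩
    x⁻¹ * (x * z)    ≈⟨ *-assoc x⁻¹ x z ⟨
    (x⁻¹ * x) * z    ≈⟨ *-congʳ (trans (*-comm x⁻¹ x) xx⁻¹≈1) ⟩
    1# * z           ≈⟨ *-identityˡ z ⟩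
    z                ∎

  *-nonzero : ∀ {x y} → ¬ x ≈ 0# → ¬ y ≈ 0# → ¬ x * y ≈ 0#
  *-nonzero {x} x≉0 y≉0 xy≈0 = y≉0 (*-cancelˡ-nonzero x≉0 (trans xy≈0 (sym (zeroʳ x))))

  monic-roots≤degree : ∀ cs {rs} → Unique rs → All (λ r → evalMonic cs r ≈ 0#) rs → length rs ≤ length cs
  monic-roots≤degree cs       {[]}     _            _               = z≤n
  monic-roots≤degree []       {r ∷ rs} _            (1≈0 ∷ _)       = contradiction 1≈0 1≉0
  monic-roots≤degree (a ∷ as) {r ∷ rs} (r≉rs ∷ urs) (pr≈0 ∷ prs≈0) =
    ≡.subst (suc (length rs) ≤_) (≡.cong suc (length-divideMonic r as))
      (s≤s (monic-roots≤degree (divideMonic r as) urs (All.zipWith quotient-root (r≉rs , prs≈0))))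
    where
    quotient-root : ∀ {z} → ¬ r ≈ z × evalMonic (a ∷ as) z ≈ 0# → evalMonic (divideMonic r as) z ≈ 0#
    quotient-root {z} (r≉z , pz≈0) = *-cancelˡ-nonzero (λ z-r≈0 → r≉z (sym (x-y≈0⇒x≈y z r z-r≈0))) (begin
      (z - r) * evalMonic (divideMonic r as) z          ≈⟨ +-identityʳ _ ⟨
      (z - r) * evalMonic (divideMonic r as) z + 0#     ≈⟨ +-congˡ pr≈0 ⟨
      (z - r) * evalMonic (divideMonic r as) z + evalMonic (a ∷ as) r
                                                        ≈⟨ evalMonic-divide r a as z ⟨
      evalMonic (a ∷ as) z                              ≈⟨ pz≈0 ⟩
      0#                                                ≈⟨ zeroʳ (z - r) ⟨
      (z - r) * 0#                                      ∎)
      where x-y≈0⇒x≈y = GroupProperties.x∙y⁻¹≈ε⇒x≈y +-group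

  ^-fixed-roots≤ : ∀ {N rs} → 2 ≤ N → Unique rs → All (λ r → r ^ N ≈ r) rs → length rs ≤ N
  ^-fixed-roots≤ {suc zero}    (s≤s ())
  ^-fixed-roots≤ {suc (suc k)} {rs} _ urs fixed =
    ≡.subst (length rs ≤_) (≡.cong (λ n → suc (suc n)) (length-replicate k {0#}))
    (monic-roots≤degree (0# ∷ - 1# ∷ List.replicate k 0#) urs (All.map root fixed))
    where
    evalMonic-zeros : ∀ k x → evalMonic (List.replicate k 0#) x ≈ x ^ k
    evalMonic-zeros zero    x = refl
    evalMonic-zeros (suc k) x = trans (+-identityˡ _) (*-congˡ (evalMonic-zeros k x))
    root : ∀ {x} → x ^ suc (suc k) ≈ x → evalMonic (0# ∷ - 1# ∷ List.replicate k 0#) x ≈ 0#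
    root {x} x^N≈x = begin
      0# + x * (- 1# + x * evalMonic (List.replicate k 0#) x)   ≈⟨ +-identityˡ _ ⟩
      x * (- 1# + x * evalMonic (List.replicate k 0#) x)        ≈⟨ distribˡ x _ _ ⟩
      x * - 1# + x * (x * evalMonic (List.replicate k 0#) x)
        ≈⟨ +-cong (trans (sym (-‿distribʳ-* x 1#)) (-‿cong (*-identityʳ x))) (*-congˡ (*-congˡ (evalMonic-zeros k x))) ⟩
      - x + x ^ suc (suc k)                                     ≈⟨ +-congˡ x^N≈x ⟩
      - x + x                                                   ≈⟨ -‿inverseˡ x ⟩
      0#                                                        ∎

module DecidableField {c ℓ} (F : Field c ℓ) (_≈?_ : Decidable (Field._≈_ F)) where
  open Field F hiding (zero)
  open UniqueList setoid
  open FieldSums F using (_^_)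
  open MonicPolynomials F using (*-cancelˡ-nonzero; *-nonzero; ^-fixed-roots≤)

  -- For α ≉ 0, multiplication by α permutes the nonzero elements of xs, so it multiplies
  -- their (nonzero) product by α ^ (length xs ∸ 1) without changing it.
  ^-length-closed : ∀ {α xs} → Unique xs → 0# ∈ xs → (∀ {x} → x ∈ xs → α * x ∈ xs) → α ^ length xs ≈ α
  ^-length-closed {α} {xs} uxs 0∈xs closed with α ≈? 0#
  ... | yes α≈0 = ≡.subst (λ n → α ^ n ≈ α) (≡.sym (length-removeAt′ xs (Any.index 0∈xs)))
                    (trans (*-congʳ α≈0) (trans (zeroˡ _) (sym α≈0)))
  ... | no  α≉0 = ≡.subst (λ n → α ^ n ≈ α) (≡.sym (length-removeAt′ xs (Any.index 0∈xs)))
                    (trans (*-congˡ α^|ys|≈1) (*-identityʳ α))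
    where
    ys : List Carrier
    ys = xs ─ 0∈xs
    ∏ᴸ : List Carrier → Carrier
    ∏ᴸ = List.foldr _*_ 1#
    ys-nonzero : ∀ {y} → y ∈ ys → ¬ y ≈ 0#
    ys-nonzero = ∈-─⇒≉ uxs 0∈xs
    ∏ᴸ-nonzero : ∀ zs → (∀ {z} → z ∈ zs → ¬ z ≈ 0#) → ¬ ∏ᴸ zs ≈ 0#
    ∏ᴸ-nonzero []       _         = 1≉0
    ∏ᴸ-nonzero (z ∷ zs) zs-nonzero =
      *-nonzero (zs-nonzero (here refl)) (∏ᴸ-nonzero zs (zs-nonzero ∘ there))
    ∏ᴸ-map : ∀ zs → ∏ᴸ (List.map (α *_) zs) ≈ α ^ length zs * ∏ᴸ zs
    ∏ᴸ-map []       = sym (*-identityˡ 1#)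
    ∏ᴸ-map (z ∷ zs) =
      trans (*-congˡ (∏ᴸ-map zs)) (CommutativeSemigroupProperties.interchange *-commutativeSemigroup α z _ _)
    αys⊆ys : ∀ {y} → y ∈ List.map (α *_) ys → y ∈ ys
    αys⊆ys y∈αys with MembershipProperties.∈-map⁻ setoid setoid y∈αys
    ... | z , z∈ys , y≈αz = MembershipProperties.∈-resp-≈ setoid (sym y≈αz)
      (∈-─ 0∈xs (closed (─-⊆ 0∈xs z∈ys)) (*-nonzero α≉0 (ys-nonzero z∈ys)))
    ∏ys≈α^|ys|∏ys : ∏ᴸ ys ≈ α ^ length ys * ∏ᴸ ys
    ∏ys≈α^|ys|∏ys = trans
      (foldr-⊆ *-commutativeMonoid (UniqueProperties.map⁺ setoid setoid (*-cancelˡ-nonzero α≉0) (Unique-─ uxs 0∈xs))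
                 (≡.sym (length-map (α *_) ys)) αys⊆ys)
      (∏ᴸ-map ys)
    α^|ys|≈1 : α ^ length ys ≈ 1#
    α^|ys|≈1 = *-cancelˡ-nonzero (∏ᴸ-nonzero ys ys-nonzero)
      (trans (*-comm _ _) (trans (sym ∏ys≈α^|ys|∏ys) (sym (*-identityʳ _))))

  FrobeniusFixed : ℕ → ℕ → Carrier → Set ℓ
  FrobeniusFixed q M x = ∃ λ r → 1 ≤ r × r ≤ M × x ^ (q ℕ.^ r) ≈ x

  frobeniusFixed-count : ∀ {q} → 2 ≤ q → ∀ M {xs} → Unique xs → All (FrobeniusFixed q M) xs →
                         length xs ≤ geometricSum q M
  frobeniusFixed-count 2≤q zero    {[]}    _ _ = z≤n
  frobeniusFixed-count 2≤q zero    {_ ∷ _} _ ((r , 1≤r , r≤0 , _) ∷ _) = contradiction (ℕ.≤-trans 1≤r r≤0) λ ()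
  frobeniusFixed-count {q} 2≤q (suc M) {xs} uxs fixed =
    ≡.subst (_≤ q ℕ.^ suc M ℕ.+ geometricSum q M) (length-filter-∁ fixedAt? xs)
      (ℕ.+-mono-≤ (^-fixed-roots≤ (2≤^suc 2≤q M) (UniqueProperties.filter⁺ setoid fixedAt? uxs)
                                     (AllProperties.all-filter fixedAt? xs))
                    (frobeniusFixed-count 2≤q M (UniqueProperties.filter⁺ setoid (∁? fixedAt?) uxs)
                                     (All.zipWith lower (AllProperties.all-filter (∁? fixedAt?) xs ,
                                                         AllProperties.filter⁺ (∁? fixedAt?) fixed))))
    where
    fixedAt? : Decidable₁ (λ x → x ^ (q ℕ.^ suc M) ≈ x)
    fixedAt? x = (x ^ (q ℕ.^ suc M)) ≈? x
    lower : ∀ {x} → ¬ x ^ (q ℕ.^ suc M) ≈ x × FrobeniusFixed q (suc M) x → FrobeniusFixed q M x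
    lower (not-fixed , r , 1≤r , r≤1+M , fixed-r) with ℕ.m≤n⇒m<n∨m≡n r≤1+M
    ... | inj₁ (s≤s r≤M) = r , 1≤r , r≤M , fixed-r
    ... | inj₂ ≡.refl    = contradiction fixed-r not-fixed

-- Power bases of extensions of finite fields
module FiniteField {c ℓ} {K : Field c ℓ} {q} (K-size : HasSize K q) where
  open Field K hiding (zero)
  open UniqueList setoid
  private
    enum : Fin q → Carrier
    enum = proj₁ K-size
    enum-surjective : ∀ x → ∃ λ i → enum i ≈ x
    enum-surjective = proj₁ (proj₂ K-size)
    enum-injective : ∀ i j → enum i ≈ enum j → i ≡ j
    enum-injective = proj₂ (proj₂ K-size)

  _≈?_ : Decidable _≈_
  x ≈? y with enum-surjective x | enum-surjective y
  ... | i , eᵢ≈x | j , eⱼ≈y with i ≟ j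
  ...   | yes ≡.refl = yes (trans (sym eᵢ≈x) eⱼ≈y)
  ...   | no  i≢j    = no (λ x≈y → i≢j (enum-injective i j (trans eᵢ≈x (trans x≈y (sym eⱼ≈y)))))

  elements : List Carrier
  elements = List.tabulate enum

  elements-unique : Unique elements
  elements-unique = UniqueProperties.tabulate⁺ setoid (enum-injective _ _)

  ∈-elements : ∀ x → x ∈ elements
  ∈-elements x = AnyProperties.tabulate⁺ (proj₁ (enum-surjective x)) (sym (proj₂ (enum-surjective x)))

  length-elements : length elements ≡ q
  length-elements = length-tabulate enum

  2≤q : 2 ≤ q
  2≤q = ≡.subst (2 ≤_) length-elements
    (⊆⇒length≤ {0# ∷ 1# ∷ []} (((λ 0≈1 → 1≉0 (sym 0≈1)) ∷ []) ∷ [] ∷ []) (λ _ → ∈-elements _))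

∀-init-last : ∀ {p n} {P : Fin (suc n) → Set p} → (∀ j → P (inject₁ j)) → P (fromℕ n) → ∀ i → P i
∀-init-last {n = zero}  _     P-last zero    = P-last
∀-init-last {n = suc n} P-init _      zero    = P-init zero
∀-init-last {n = suc n} P-init P-last (suc i) = ∀-init-last (P-init ∘ suc) P-last i

transition : ∀ {p q} {P : ℕ → Set p} {Q : ℕ → Set q} → (∀ n → P n ⊎ Q n) →
             ∀ k {a} → P a → ¬ P (k ℕ.+ a) → ∃ λ r → a ≤ r × r < k ℕ.+ a × P r × Q (suc r)
transition P⊎Q zero    Pa ¬Pa = contradiction Pa ¬Pa
transition {P = P} P⊎Q (suc k) {a} Pa ¬P[1+k+a] with P⊎Q (suc a)
... | inj₂ Q[1+a] = a , ℕ.≤-refl , s≤s (ℕ.m≤n+m a k) , Pa , Q[1+a]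
... | inj₁ P[1+a] with transition P⊎Q k P[1+a] (≡.subst (λ n → ¬ P n) (≡.sym (ℕ.+-suc k a)) ¬P[1+k+a])
...   | r , 1+a≤r , r<k+1+a , Pr , Q[1+r] =
        r , ℕ.≤-trans (ℕ.n≤1+n a) 1+a≤r , ≡.subst (r <_) (ℕ.+-suc k a) r<k+1+a , Pr , Q[1+r]

module FiniteExtension {c ℓ c′ ℓ′} {K : Field c ℓ} {q} (K-size : HasSize K q)
                       {m} (E : Extension K c′ ℓ′ m) where
  open Coordinates E
  open FiniteField {K = K} K-size using (_≈?_; elements; elements-unique; ∈-elements; length-elements; 2≤q)
  open UniqueList L.setoid using (_∈_; Unique; ⊆⇒length≤)
  private
    module VE = VectorEnumeration K.setoid
    module ≋ {t} = Setoid (≋-setoid K.setoid t)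

  vectors : ∀ t → List (Vector K.Carrier t)
  vectors = VE.vectors elements

  _≈L?_ : Decidable L._≈_
  x ≈L? y = Dec.map′ (λ cx≈cy → L.trans (coord-spec x) (L.trans (lincomb-cong basis cx≈cy) (L.sym (coord-spec y))))
                     coord-cong (FinProperties.all? (λ i → coord x i ≈? coord y i))

  private
    module DL = DecidableField L _≈L?_

  span : ∀ {t} → Vector L.Carrier t → List L.Carrier
  span {t} v = List.map (lincomb v) (vectors t)

  length-span : ∀ {t} (v : Vector L.Carrier t) → length (span v) ≡ q ℕ.^ t
  length-span {t} v = ≡.trans (length-map (lincomb v) (vectors t))
    (≡.trans (VE.length-vectors elements t) (≡.cong (ℕ._^ t) length-elements))

  ∈-span : ∀ {t} (v : Vector L.Carrier t) w → lincomb v w ∈ span v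
  ∈-span {t} v w = MembershipProperties.∈-map⁺ (≋-setoid K.setoid t) L.setoid (lincomb-cong v)
                     (VE.vectors-complete ∈-elements t w)

  span-lincomb : ∀ {t} (v : Vector L.Carrier t) {y} → y ∈ span v → ∃ λ w → y L.≈ lincomb v w
  span-lincomb {t} v y∈ with MembershipProperties.∈-map⁻ (≋-setoid K.setoid t) L.setoid y∈
  ... | w , _ , y≈vw = w , y≈vw

  span-unique : ∀ {t} {v : Vector L.Carrier t} → Independent v → Unique (span v)
  span-unique {t} {v} indep = UniqueProperties.map⁺ (≋-setoid K.setoid t) L.setoid
    (lincomb-injective v indep _ _) (VE.vectors-unique elements-unique t)

  Dependent : ∀ {t} → Vector L.Carrier t → Set (c ⊔ ℓ ⊔ ℓ′)
  Dependent v = ∃ λ w → lincomb v w L.≈ L.0# × ¬ (∀ i → w i K.≈ K.0#)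

  private
    OnlyTrivialRelation : ∀ {t} → Vector L.Carrier t → Vector K.Carrier t → Set (ℓ ⊔ ℓ′)
    OnlyTrivialRelation v w = lincomb v w L.≈ L.0# → ∀ i → w i K.≈ K.0#

    onlyTrivialRelation? : ∀ {t} (v : Vector L.Carrier t) → Decidable₁ (OnlyTrivialRelation v)
    onlyTrivialRelation? v w = (lincomb v w ≈L? L.0#) →-dec FinProperties.all? (λ i → w i ≈? K.0#)

    onlyTrivialRelation-resp : ∀ {t} (v : Vector L.Carrier t) {w w′} → w ≋.≈ w′ →
                               OnlyTrivialRelation v w → OnlyTrivialRelation v w′
    onlyTrivialRelation-resp v w≋w′ triv vw′≈0 i =
      K.trans (K.sym (w≋w′ i)) (triv (L.trans (lincomb-cong v w≋w′) vw′≈0) i)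

  independent⊎dependent : ∀ {t} (v : Vector L.Carrier t) → Independent v ⊎ Dependent v
  independent⊎dependent {t} v with All.all? (onlyTrivialRelation? v) (vectors t)
  ... | yes all-trivial = inj₁ (λ w → All.lookupₛ (≋-setoid K.setoid t) (onlyTrivialRelation-resp v)
                                        all-trivial (VE.vectors-complete ∈-elements t w))
  ... | no ¬all-trivial with Any.satisfied (AllProperties.¬All⇒Any¬ (onlyTrivialRelation? v) (vectors t) ¬all-trivial)
  ...   | w , nontrivial with lincomb v w ≈L? L.0#
  ...     | yes vw≈0 = inj₂ (w , vw≈0 , λ w≈0 → nontrivial (λ _ → w≈0))
  ...     | no  vw≉0 = contradiction (λ vw≈0 → contradiction vw≈0 vw≉0) nontrivial

  independent? : ∀ {t} (v : Vector L.Carrier t) → Dec (Independent v)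
  independent? v with independent⊎dependent v
  ... | inj₁ indep                         = yes indep
  ... | inj₂ (w , w-relation , nontrivial) = no (λ indep → nontrivial (indep w w-relation))

  ι≈0⇒≈0 : ∀ {x} → ι x L.≈ L.0# → x K.≈ K.0#
  ι≈0⇒≈0 {x} ιx≈0 with x ≈? K.0#
  ... | yes x≈0 = x≈0
  ... | no  x≉0 with K.inverse x x≉0
  ...   | x⁻¹ , xx⁻¹≈1 = contradiction (begin
    L.1#               ≈⟨ 1#-homo ⟨
    ι K.1#             ≈⟨ ι-cong xx⁻¹≈1 ⟨
    ι (x K.* x⁻¹)      ≈⟨ *-homo x x⁻¹ ⟩
    ι x L.* ι x⁻¹      ≈⟨ L.*-congʳ ιx≈0 ⟩
    L.0# L.* ι x⁻¹     ≈⟨ L.zeroˡ (ι x⁻¹) ⟩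
    L.0#               ∎) L.1≉0
    where open SetoidReasoning L.setoid

  independent-powers-1 : ∀ α → Independent (powers 1 α)
  independent-powers-1 α w w₀+0≈0 zero = ι≈0⇒≈0 (L.trans (L.sym (L.*-identityʳ (ι (w zero))))
                                                         (L.trans (L.sym (L.+-identityʳ _)) w₀+0≈0))

  top-power-in-span : ∀ {α r} → Independent (powers r α) → Dependent (powers (suc r) α) →
                      ∃ λ u → α ^ r L.≈ lincomb (powers r α) u
  top-power-in-span {α} {r} indep (w , w-relation , nontrivial) = solve-for-top (K.inverse lead lead≉0)
    where
    open SetoidReasoning L.setoid
    module +L = GroupProperties L.+-group
    lead : K.Carrier
    lead = w (fromℕ r)
    S : L.Carrier
    S = lincomb (powers r α) (w ∘ inject₁)
    split : lincomb (powers (suc r) α) w L.≈ S L.+ ι lead L.* α ^ r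
    split = L.trans (ΣL.∑-init-last (λ i → ι (w i) L.* α ^ toℕ i))
      (L.+-cong (ΣL.∑-cong {r} (λ i → L.*-congˡ {ι (w (inject₁ i))} (L.reflexive (≡.cong (α ^_) (toℕ-inject₁ i)))))
                (L.*-congˡ (L.reflexive (≡.cong (α ^_) (toℕ-fromℕ r)))))
    S+lead·α^r≈0 : S L.+ ι lead L.* α ^ r L.≈ L.0#
    S+lead·α^r≈0 = L.trans (L.sym split) w-relation
    lead≉0 : ¬ lead K.≈ K.0#
    lead≉0 lead≈0 = nontrivial (∀-init-last (indep (w ∘ inject₁) S≈0) lead≈0)
      where
      S≈0 : S L.≈ L.0#
      S≈0 = begin
        S                          ≈⟨ L.+-identityʳ S ⟨
        S L.+ L.0#                 ≈⟨ L.+-congˡ (L.trans (L.*-congʳ (L.trans (ι-cong lead≈0) 0#-homo)) (L.zeroˡ _)) ⟨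
        S L.+ ι lead L.* α ^ r     ≈⟨ S+lead·α^r≈0 ⟩
        L.0#                       ∎
    solve-for-top : (∃ λ y → lead K.* y K.≈ K.1#) → ∃ λ u → α ^ r L.≈ lincomb (powers r α) u
    solve-for-top (lead⁻¹ , lead·lead⁻¹≈1) = (λ i → lead⁻¹ K.* K.- w (inject₁ i)) , (begin
      α ^ r                                                  ≈⟨ L.*-identityˡ _ ⟨
      L.1# L.* α ^ r
        ≈⟨ L.*-congʳ (L.trans (ι-cong (K.trans (K.*-comm lead⁻¹ lead) lead·lead⁻¹≈1)) 1#-homo) ⟨
      ι (lead⁻¹ K.* lead) L.* α ^ r
        ≈⟨ L.trans (L.*-congʳ (*-homo lead⁻¹ lead)) (L.*-assoc _ _ _) ⟩
      ι lead⁻¹ L.* (ι lead L.* α ^ r)                        ≈⟨ L.*-congˡ (+L.inverseʳ-unique S _ S+lead·α^r≈0) ⟩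
      ι lead⁻¹ L.* L.- S                                     ≈⟨ L.*-congˡ (lincomb-neg (powers r α) (w ∘ inject₁)) ⟨
      ι lead⁻¹ L.* lincomb (powers r α) (λ i → K.- w (inject₁ i))
        ≈⟨ lincomb-* (powers r α) lead⁻¹ (λ i → K.- w (inject₁ i)) ⟨
      lincomb (powers r α) (λ i → lead⁻¹ K.* K.- w (inject₁ i)) ∎)

  *-powers-closed : ∀ {α r} → (∃ λ u → α ^ r L.≈ lincomb (powers r α) u) →
                    ∀ i → ∃ λ u → α L.* powers r α i L.≈ lincomb (powers r α) u
  *-powers-closed {α} {r} α^r∈span i with suc (toℕ i) ℕ.<? r
  ... | yes 1+i<r = δ K (fromℕ< 1+i<r) , L.sym (L.trans (lincomb-δ (powers r α) (fromℕ< 1+i<r))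
                                                        (L.reflexive (≡.cong (α ^_) (toℕ-fromℕ< 1+i<r))))
  ... | no  1+i≮r = ≡.subst (λ s → ∃ λ u → α ^ s L.≈ lincomb (powers r α) u)
                            (≡.sym (ℕ.≤-antisym (toℕ<n i) (ℕ.≮⇒≥ 1+i≮r))) α^r∈span


  frobenius : ∀ {α r} → Independent (powers r α) → Dependent (powers (suc r) α) → α ^ (q ℕ.^ r) L.≈ α
  frobenius {α} {r} indep dep = ≡.subst (λ n → α ^ n L.≈ α) (length-span (powers r α))
    (DL.^-length-closed (span-unique indep) 0∈span α-closed)
    where
    0∈span : L.0# ∈ span (powers r α)
    0∈span = MembershipProperties.∈-resp-≈ L.setoid (lincomb-zero (powers r α)) (∈-span (powers r α) (λ _ → K.0#))
    α-closed : ∀ {x} → x ∈ span (powers r α) → α L.* x ∈ span (powers r α)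
    α-closed {x} x∈ = MembershipProperties.∈-resp-≈ L.setoid
      (L.trans (L.sym (proj₂ αvw∈span)) (L.*-congˡ (L.sym (proj₂ x∈span)))) (∈-span (powers r α) (proj₁ αvw∈span))
      where
      x∈span : ∃ λ w → x L.≈ lincomb (powers r α) w
      x∈span = span-lincomb (powers r α) x∈
      αvw∈span : ∃ λ w′ → α L.* lincomb (powers r α) (proj₁ x∈span) L.≈ lincomb (powers r α) w′
      αvw∈span = *-lincomb-closed (powers r α) α (*-powers-closed (top-power-in-span indep dep)) (proj₁ x∈span)

  elementsL : List L.Carrier
  elementsL = span basis

  ∈-elementsL : ∀ x → x ∈ elementsL
  ∈-elementsL x = MembershipProperties.∈-resp-≈ L.setoid (L.sym (coord-spec x)) (∈-span basis (coord x))

  nonPrimitive-frobeniusFixed : 1 ≤ m → ∀ α → ¬ Independent (powers m α) → DL.FrobeniusFixed q (m ∸ 1) α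
  nonPrimitive-frobeniusFixed (s≤s {n = m′} _) α dependent = fixed
    (transition (λ t → independent⊎dependent (powers t α)) m′ (independent-powers-1 α)
                (≡.subst (λ t → ¬ Independent (powers t α)) (ℕ.+-comm 1 m′) dependent))
    where
    fixed : (∃ λ r → 1 ≤ r × r < m′ ℕ.+ 1 × Independent (powers r α) × Dependent (powers (suc r) α)) →
            DL.FrobeniusFixed q m′ α
    fixed (r , 1≤r , r<m′+1 , indep , dep) =
      r , 1≤r , ℕ.≤-pred (≡.subst (r <_) (ℕ.+-comm m′ 1) r<m′+1) , frobenius indep dep

  independent-powers : 1 ≤ m → ∃ λ α → Independent (powers m α)
  independent-powers 1≤m = pick (Any.any? (λ α → independent? (powers m α)) elementsL)
    where
    |L|≤geometricSum : ¬ Any (λ α → Independent (powers m α)) elementsL → q ℕ.^ m ≤ geometricSum q (m ∸ 1)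
    |L|≤geometricSum none = ≡.subst (_≤ geometricSum q (m ∸ 1)) (length-span basis)
      (DL.frobeniusFixed-count 2≤q (m ∸ 1) (span-unique independent)
        (All.map (nonPrimitive-frobeniusFixed 1≤m _) (AllProperties.¬Any⇒All¬ elementsL none)))
    geometricSum<|L| : geometricSum q (m ∸ 1) < q ℕ.^ m
    geometricSum<|L| = ≡.subst (geometricSum q (m ∸ 1) <_) (≡.cong (q ℕ.^_) (ℕ.suc-pred m {{ℕ.>-nonZero 1≤m}}))
                               (geometricSum<^suc 2≤q (m ∸ 1))
    pick : Dec (Any (λ α → Independent (powers m α)) elementsL) → ∃ λ α → Independent (powers m α)
    pick (yes some) = Any.satisfied some
    pick (no  none) = contradiction (|L|≤geometricSum none) (ℕ.<⇒≱ geometricSum<|L|)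

  -- Otherwise the span and one element outside it would give q ^ m + 1 distinct elements of L.
  independent⇒spans : ∀ {v : Vector L.Carrier m} → Independent v → Spans v
  independent⇒spans {v} indep y = pick (Any.any? (y ≈L?_) (span v))
    where
    pick : Dec (y ∈ span v) → ∃ λ w → y L.≈ lincomb v w
    pick (yes y∈span) = span-lincomb v y∈span
    pick (no  y∉span) = contradiction
      (≡.subst₂ (λ a b → suc a ≤ b) (length-span v) (length-span basis)
        (⊆⇒length≤ (MembershipProperties.∉⇒All[≉] L.setoid y∉span ∷ span-unique indep)
                    (λ {x} _ → ∈-elementsL x)))
      (ℕ.<-irrefl ≡.refl)

  powerBasis-exists : 1 ≤ m → ∃ PowerBasis
  powerBasis-exists 1≤m with independent-powers 1≤m
  ... | α , indep = α , record { powers-span = independent⇒spans indep ; powers-independent = indep }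

module _ {c ℓ c₁ ℓ₁ c₂ ℓ₂} {K : Field c ℓ} {q} (K-size : HasSize K q) {n l}
         (En : Extension K c₁ ℓ₁ n) (El : Extension K c₂ ℓ₂ l) where

  finiteExtension-⪯ : 1 ≤ n → ∀ e → e ℕ.* (n ∸ 1) < l →
                      _⪯_ K (structTensor En (suc e)) (structTensor El (suc e))
  finiteExtension-⪯ 1≤n e e[n-1]<l = via (FiniteExtension.powerBasis-exists K-size En 1≤n)
                                        (FiniteExtension.powerBasis-exists K-size El (ℕ.≤-trans (s≤s z≤n) e[n-1]<l))
    where
    via : ∃ (Coordinates.PowerBasis En) → ∃ (Coordinates.PowerBasis El) →
          _⪯_ K (structTensor En (suc e)) (structTensor El (suc e))
    via (β , β-basis) (α , α-basis) =
      ⪯-trans K {T = structTensor Enᵝ (suc e)} {U = structTensor El (suc e)} (⪯-withPowerBasis En β-basis e)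
        (⪯-trans K {T = structTensor Elᵅ (suc e)} {U = structTensor El (suc e)}
          (powerBasis-⪯ β-basis α-basis e e[n-1]<l) (withPowerBasis-⪯ El α-basis e))
      where
      Enᵝ : Extension K c₁ ℓ₁ n
      Enᵝ = Coordinates.withPowerBasis En β β-basis
      Elᵅ : Extension K c₂ ℓ₂ l
      Elᵅ = Coordinates.withPowerBasis El α α-basis

open import Data.Nat.Base using (_*_)

lemma3p5 : ∀ {c ℓ c₁ ℓ₁ c₂ ℓ₂ : Level} (K : Field c ℓ) (q : ℕ) →
           IsPrimePower q → HasSize K q →
           (d : ℕ) → 2 ≤ d → (n l : ℕ) → 1 ≤ n → 1 ≤ l →
           (d ∸ 1) * (n ∸ 1) ≤ l ∸ 1 →
           (Fqn : Extension K c₁ ℓ₁ n) (Fql : Extension K c₂ ℓ₂ l) →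
           ∀ (s : ℕ) → _⪯_ K (Id K d s) (structTensor Fqn d) →
           ∃ λ (s' : ℕ) → s ≤ s' × _⪯_ K (Id K d s') (structTensor Fql d)
-- Being a prime power is not needed beyond HasSize, and 2 ≤ d only rules out the dummy case d = 0.
lemma3p5 K q _ K-size (suc e) _ n (suc l) 1≤n _ e[n-1]≤l Fqn Fql s Id⪯Tn =
  s , ℕ.≤-refl , ⪯-trans K {T = structTensor Fqn (suc e)} {U = structTensor Fql (suc e)}
                   Id⪯Tn (finiteExtension-⪯ K-size Fqn Fql 1≤n e (s≤s e[n-1]≤l))
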